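{- Let $k\ge1$ and $n\ge 1$ be integers. Then $s^{(k)}_{n+1,0,r+1}=s^{(k)}_{n,k,r}$ for all integers $r$ with $0\le r<n$, and $s^{(k)}_{n+1,0,n+1}=s^{(k)}_{n,k,n}+k\,C_{n,k}$, where $C_{n,k}=\frac{k+1}{(k+1)n+k+1}\binom{(k+1)n+k+1}{n}$.
   Context: For a positive integer $k$ and an integer $0\le t\le k$, a $k_t$-Dyck path is a lattice path consisting of up-steps $(1,k)$ and down-steps $(1,-1)$ that starts at $(0,0)$, stays weakly above the line $y=-t$, and ends on the line $y=0$. For $n\ge1$ and $0\le r\le n$, $s^{(k)}_{n,t,r}$ denotes the total number, summed over all $k_t$-Dyck paths with $n$ up-steps, of down-steps between the $r$-th and $(r+1)$-th up-steps (before the first up-step if $r=0$, after the last up-step if $r=n$). -}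

module Defs where

open import Data.Nat using (ℕ; zero; suc; _+_; _*_; _∸_; _/_; _≡ᵇ_)
open import Data.Nat.Combinatorics using (_C_)
open import Data.Bool using (Bool; true; false; _∧_)
open import Data.List using (List; []; _∷_; map; _++_; filterᵇ)
open import Data.Nat.ListAction using (sum)

-- Steps of a k_t-Dyck path: U = up-step (1,k), D = down-step (1,-1).
data Step : Set where
  U D : Step

words : ℕ → ℕ → List (List Step)
words zero    zero    = [] ∷ []
words zero    (suc b) = map (D ∷_) (words zero b)
words (suc a) zero    = map (U ∷_) (words a zero)
words (suc a) (suc b) = map (U ∷_) (words a (suc b)) ++ map (D ∷_) (words (suc a) b)

-- Walk with shifted height h = y + t (so "weakly above y = -t" is h ≥ 0);
-- returns true iff the walk never goes below 0 and ends at height t (i.e. y = 0).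
walkOK : ℕ → ℕ → ℕ → List Step → Bool
walkOK k t h []          = h ≡ᵇ t
walkOK k t h (U ∷ p)     = walkOK k t (h + k) p
walkOK k t zero (D ∷ p)  = false
walkOK k t (suc h) (D ∷ p) = walkOK k t h p

isDyck : ℕ → ℕ → List Step → Bool
isDyck k t p = walkOK k t t p

-- All k_t-Dyck paths with n up-steps (such a path necessarily has k*n down-steps).
dyckPaths : ℕ → ℕ → ℕ → List (List Step)
dyckPaths k t n = filterᵇ (isDyck k t) (words n (k * n))

-- Number of down-steps between the r-th and (r+1)-th up-steps
-- (before the first up-step if r = 0, after the last if r = number of up-steps).
gap : ℕ → List Step → ℕ
gap r       []      = 0
gap zero    (U ∷ p) = 0
gap zero    (D ∷ p) = suc (gap zero p)
gap (suc r) (U ∷ p) = gap r p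
gap (suc r) (D ∷ p) = gap (suc r) p

s : ℕ → ℕ → ℕ → ℕ → ℕ
s k n t r = sum (map (gap r) (dyckPaths k t n))

-- C_{n,k} = (k+1)/((k+1)n+k+1) * binom((k+1)n+k+1, n); the denominator
-- (k+1)n+k+1 is written as (k+1)(n+1) = suc k * suc n. The division is exact.
Cnk : ℕ → ℕ → ℕ
Cnk n k = (suc k * ((suc k * suc n) C n)) / (suc k * suc n)

module Submission where

-- A k_0-Dyck path P with n+1 up-steps must start with an up-step,
-- after which it sits at height k.  Its last up-step leaves it at height at
-- least k, so P ends with at least k down-steps; removing exactly k of them
-- gives a bijection  P = U ∷ Q ++ Dᵏ  with the k_k-Dyck paths Q with n
-- up-steps.  Under this bijection the (r+1)-th gap of P is the r-th gap of Q,
-- except that the last gap grows by k.  Hence the first claim, and the second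
-- with the extra term  k · #(k_k-Dyck paths with n up-steps), which by the
-- same bijection is the number of k_0-Dyck paths with n+1 up-steps, the
-- Fuss–Catalan number C_{n,k}.
--
-- The proof does not use the
-- hypotheses 1 ≤ k and 1 ≤ n: the identities hold for all k and n.

open import Defs
open import Data.Nat using (ℕ; zero; suc; _+_; _*_; _≤_; _<_; _/_; z≤n; s≤s)
open import Data.Nat.Properties
open import Data.Nat.DivMod using (m*n/n≡m)
open import Data.Nat.Combinatorics using (_C_; nCk≡nC[n∸k]; nCn≡1; nCk+nC[k+1]≡[n+1]C[k+1])
open import Data.Nat.Combinatorics.Specification using (k>n⇒nCk≡0)
open import Data.Nat.ListAction using (sum)
open import Data.Nat.Tactic.RingSolver using (solve-∀)
open import Data.Bool using (Bool; true; false; if_then_else_; T)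
open import Data.List using (List; []; _∷_; _++_; map; replicate; filterᵇ)
open import Data.List.Relation.Unary.All as All using (All; []; _∷_)
open import Data.List.Relation.Unary.All.Properties using (++⁺; map⁺)
open import Data.Product using (_×_; _,_; proj₁)
open import Data.Empty using (⊥-elim)
open import Relation.Binary.PropositionalEquality
open ≡-Reasoning

weight : (List Step → Bool) → (List Step → ℕ) → List (List Step) → ℕ
weight p f []       = 0
weight p f (x ∷ xs) = if p x then f x + weight p f xs else weight p f xs

one : List Step → ℕ
one _ = 1

weight-filter : ∀ p f xs → sum (map f (filterᵇ p xs)) ≡ weight p f xs
weight-filter p f []       = refl
weight-filter p f (x ∷ xs) with p x
... | true  = cong (f x +_) (weight-filter p f xs)
... | false = weight-filter p f xs

weight-++ : ∀ p f xs ys → weight p f (xs ++ ys) ≡ weight p f xs + weight p f ys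
weight-++ p f []       ys = refl
weight-++ p f (x ∷ xs) ys with p x
... | true  = trans (cong (f x +_) (weight-++ p f xs ys)) (sym (+-assoc (f x) _ _))
... | false = weight-++ p f xs ys

weight-map : ∀ p f g xs →
  weight p f (map g xs) ≡ weight (λ w → p (g w)) (λ w → f (g w)) xs
weight-map p f g []       = refl
weight-map p f g (x ∷ xs) with p (g x)
... | true  = cong (f (g x) +_) (weight-map p f g xs)
... | false = weight-map p f g xs

weight-+ : ∀ p f g xs → weight p (λ w → f w + g w) xs ≡ weight p f xs + weight p g xs
weight-+ p f g []       = refl
weight-+ p f g (x ∷ xs) with p x
... | true  = trans (cong (f x + g x +_) (weight-+ p f g xs))
                    (+-interchange (f x) (g x) (weight p f xs) (weight p g xs))
  where
  +-interchange : ∀ a b c d → a + b + (c + d) ≡ a + c + (b + d)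
  +-interchange = solve-∀
... | false = weight-+ p f g xs

weight-cong : ∀ p {f g} xs → All (λ w → f w ≡ g w) xs → weight p f xs ≡ weight p g xs
weight-cong p []       []         = refl
weight-cong p (x ∷ xs) (fx≡gx ∷ eqs) with p x
... | true  = cong₂ _+_ fx≡gx (weight-cong p xs eqs)
... | false = weight-cong p xs eqs

weight-const : ∀ p c xs → weight p (λ _ → c) xs ≡ c * weight p one xs
weight-const p c []       = sym (*-zeroʳ c)
weight-const p c (x ∷ xs) with p x
... | true  = trans (cong (c +_) (weight-const p c xs)) (sym (*-suc c _))
... | false = weight-const p c xs

weight-none : ∀ p f xs → All (λ w → p w ≡ false) xs → weight p f xs ≡ 0
weight-none p f []       []           = refl
weight-none p f (x ∷ xs) (px≡false ∷ rest) rewrite px≡false = weight-none p f xs rest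

ups downs : List Step → ℕ
ups []      = 0
ups (U ∷ w) = suc (ups w)
ups (D ∷ w) = ups w
downs []      = 0
downs (U ∷ w) = downs w
downs (D ∷ w) = suc (downs w)

descent : ℕ → List Step
descent t = replicate t D

words-shape : ∀ a b → All (λ w → ups w ≡ a × downs w ≡ b) (words a b)
words-shape zero    zero    = (refl , refl) ∷ []
words-shape zero    (suc b) = map⁺ (All.map (λ (u , d) → u , cong suc d) (words-shape zero b))
words-shape (suc a) zero    = map⁺ (All.map (λ (u , d) → cong suc u , d) (words-shape a zero))
words-shape (suc a) (suc b) =
  ++⁺ (map⁺ (All.map (λ (u , d) → cong suc u , d) (words-shape a (suc b))))
      (map⁺ (All.map (λ (u , d) → u , cong suc d) (words-shape (suc a) b)))

words-zero : ∀ d → words 0 d ≡ descent d ∷ []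
words-zero zero    = refl
words-zero (suc d) = cong (map (D ∷_)) (words-zero d)

weight-words-suc : ∀ p f a b → weight p f (words (suc a) (suc b)) ≡
  weight (λ w → p (U ∷ w)) (λ w → f (U ∷ w)) (words a (suc b)) +
  weight (λ w → p (D ∷ w)) (λ w → f (D ∷ w)) (words (suc a) b)
weight-words-suc p f a b =
  trans (weight-++ p f (map (U ∷_) (words a (suc b))) (map (D ∷_) (words (suc a) b)))
        (cong₂ _+_ (weight-map p f (U ∷_) (words a (suc b)))
                   (weight-map p f (D ∷_) (words (suc a) b)))

module _ (k : ℕ) where

  walk-balance : ∀ t h w → walkOK k t h w ≡ true → h + k * ups w ≡ t + downs w
  walk-balance t h [] ok = begin
    h + k * 0  ≡⟨ cong (h +_) (*-zeroʳ k) ⟩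
    h + 0      ≡⟨ +-identityʳ h ⟩
    h          ≡⟨ ≡ᵇ⇒≡ h t (subst T (sym ok) _) ⟩
    t          ≡⟨ sym (+-identityʳ t) ⟩
    t + 0      ∎
  walk-balance t h (U ∷ w) ok = begin
    h + k * suc (ups w)  ≡⟨ cong (h +_) (*-suc k (ups w)) ⟩
    h + (k + k * ups w)  ≡⟨ sym (+-assoc h k _) ⟩
    h + k + k * ups w    ≡⟨ walk-balance t (h + k) w ok ⟩
    t + downs w          ∎
  walk-balance t (suc h) (D ∷ w) ok =
    trans (cong suc (walk-balance t h w ok)) (sym (+-suc t (downs w)))

  walk-descent : ∀ h w t → walkOK k 0 h (w ++ descent t) ≡ walkOK k t h w
  walk-descent h       []      zero    = refl
  walk-descent zero    []      (suc t) = refl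
  walk-descent (suc h) []      (suc t) = walk-descent h [] t
  walk-descent h       (U ∷ w) t       = walk-descent (h + k) w t
  walk-descent zero    (D ∷ w) t       = refl
  walk-descent (suc h) (D ∷ w) t       = walk-descent h w t

  from-floor : ∀ t f xs → weight (λ w → walkOK k t 0 (D ∷ w)) f xs ≡ 0
  from-floor t f xs = weight-none _ f xs (All.universal (λ _ → refl) xs)

  no-short-descent : ∀ h a d → d < k →
                     All (λ w → walkOK k 0 h w ≡ false) (words (suc a) d)
  no-short-descent h a d d<k = All.map (λ {w} → rejected w) (words-shape (suc a) d)
    where
    rejected : ∀ w → ups w ≡ suc a × downs w ≡ d → walkOK k 0 h w ≡ false
    rejected w (u , e) with walkOK k 0 h w in accepted
    ... | false = refl
    ... | true  = ⊥-elim (<⇒≱ d<k (subst (k ≤_) balance k≤h+k[a+1]))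
      where
      k≤h+k[a+1] : k ≤ h + k * suc a
      k≤h+k[a+1] = ≤-trans (m≤m*n k (suc a)) (m≤n+m _ h)
      balance : h + k * suc a ≡ d
      balance = trans (cong (λ m → h + k * m) (sym u)) (trans (walk-balance 0 h w accepted) e)

  -- First-step decomposition: from height 0 the first step is forced up.
  up-first : ∀ t f a b → weight (walkOK k t 0) f (words (suc a) b) ≡
                         weight (walkOK k t k) (λ w → f (U ∷ w)) (words a b)
  up-first t f a zero    = weight-map _ f (U ∷_) (words a zero)
  up-first t f a (suc b) = begin
    weight (walkOK k t 0) f (words (suc a) (suc b))
      ≡⟨ weight-words-suc (walkOK k t 0) f a b ⟩
    weight (walkOK k t k) (λ w → f (U ∷ w)) (words a (suc b)) +
    weight (λ w → walkOK k t 0 (D ∷ w)) (λ w → f (D ∷ w)) (words (suc a) b)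
      ≡⟨ cong (weight (walkOK k t k) (λ w → f (U ∷ w)) (words a (suc b)) +_)
              (from-floor t _ (words (suc a) b)) ⟩
    weight (walkOK k t k) (λ w → f (U ∷ w)) (words a (suc b)) + 0
      ≡⟨ +-identityʳ _ ⟩
    weight (walkOK k t k) (λ w → f (U ∷ w)) (words a (suc b)) ∎

  target-shift : ∀ t → t ≤ k → ∀ h a b f →
    weight (walkOK k 0 h) f (words a (b + t)) ≡
    weight (walkOK k t h) (λ w → f (w ++ descent t)) (words a b)
  target-shift t _ h zero zero f = begin
    weight (walkOK k 0 h) f (words 0 t)
      ≡⟨ cong (weight (walkOK k 0 h) f) (words-zero t) ⟩
    (if walkOK k 0 h (descent t) then f (descent t) + 0 else 0)
      ≡⟨ cong (λ β → if β then f (descent t) + 0 else 0) (walk-descent h [] t) ⟩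
    (if walkOK k t h [] then f (descent t) + 0 else 0) ∎
  target-shift t _ zero zero (suc b) f =
    trans (weight-map (walkOK k 0 0) f (D ∷_) (words 0 (b + t)))
      (trans (from-floor 0 _ (words 0 (b + t)))
             (sym (trans (weight-map (walkOK k t 0) f′ (D ∷_) (words 0 b))
                         (from-floor t _ (words 0 b)))))
    where
    f′ : List Step → ℕ
    f′ w = f (w ++ descent t)
  target-shift t t≤k (suc h) zero (suc b) f =
    trans (weight-map (walkOK k 0 (suc h)) f (D ∷_) (words 0 (b + t)))
      (trans (target-shift t t≤k h zero b (λ w → f (D ∷ w)))
             (sym (weight-map (walkOK k t (suc h)) f′ (D ∷_) (words 0 b))))
    where
    f′ : List Step → ℕ
    f′ w = f (w ++ descent t)
  target-shift zero _ h (suc a) zero f =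
    trans (weight-map (walkOK k 0 h) f (U ∷_) (words a zero))
      (trans (target-shift zero z≤n (h + k) a zero (λ w → f (U ∷ w)))
             (sym (weight-map (walkOK k 0 h) (λ w → f (w ++ [])) (U ∷_) (words a zero))))
  target-shift (suc t) t≤k h (suc a) zero f = begin
    weight (walkOK k 0 h) f (words (suc a) (suc t))
      ≡⟨ weight-words-suc (walkOK k 0 h) f a t ⟩
    weight (walkOK k 0 (h + k)) (λ w → f (U ∷ w)) (words a (suc t)) +
    weight (λ w → walkOK k 0 h (D ∷ w)) (λ w → f (D ∷ w)) (words (suc a) t)
      ≡⟨ cong₂ _+_ (target-shift (suc t) t≤k (h + k) a zero (λ w → f (U ∷ w)))
                   (down-first h) ⟩
    weight (walkOK k (suc t) (h + k)) (λ w → f (U ∷ w ++ descent (suc t))) (words a zero) + 0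
      ≡⟨ +-identityʳ _ ⟩
    weight (walkOK k (suc t) (h + k)) (λ w → f (U ∷ w ++ descent (suc t))) (words a zero)
      ≡⟨ sym (weight-map (walkOK k (suc t) h) f′ (U ∷_) (words a zero)) ⟩
    weight (walkOK k (suc t) h) (λ w → f (w ++ descent (suc t))) (words (suc a) zero) ∎
    where
    f′ : List Step → ℕ
    f′ w = f (w ++ descent (suc t))
    down-first : ∀ h →
      weight (λ w → walkOK k 0 h (D ∷ w)) (λ w → f (D ∷ w)) (words (suc a) t) ≡ 0
    down-first zero    = from-floor 0 _ (words (suc a) t)
    down-first (suc h) = weight-none (walkOK k 0 h) _ _ (no-short-descent h a t t≤k)
  target-shift t t≤k h (suc a) (suc b) f =
    trans (weight-words-suc (walkOK k 0 h) f a (b + t))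
      (trans (cong₂ _+_ (target-shift t t≤k (h + k) a (suc b) (λ w → f (U ∷ w)))
                        (down-first h))
             (sym (weight-words-suc (walkOK k t h) (λ w → f (w ++ descent t)) a b)))
    where
    down-first : ∀ h →
      weight (λ w → walkOK k 0 h (D ∷ w)) (λ w → f (D ∷ w)) (words (suc a) (b + t)) ≡
      weight (λ w → walkOK k t h (D ∷ w)) (λ w → f (D ∷ w ++ descent t)) (words (suc a) b)
    down-first zero    = trans (from-floor 0 _ (words (suc a) (b + t)))
                               (sym (from-floor t _ (words (suc a) b)))
    down-first (suc h) = target-shift t t≤k h (suc a) b (λ w → f (D ∷ w))

bonus : ℕ → ℕ → ℕ → ℕ
bonus t zero    zero    = t
bonus t zero    (suc a) = 0
bonus t (suc r) zero    = 0
bonus t (suc r) (suc a) = bonus t r a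

bonus-< : ∀ t {r a} → r < a → bonus t r a ≡ 0
bonus-< t {zero}  {suc a} _         = refl
bonus-< t {suc r} {suc a} (s≤s r<a) = bonus-< t r<a

bonus-self : ∀ t a → bonus t a a ≡ t
bonus-self t zero    = refl
bonus-self t (suc a) = bonus-self t a

gap-descent : ∀ r t → gap r (descent t) ≡ bonus t r 0
gap-descent zero    zero    = refl
gap-descent zero    (suc t) = cong suc (gap-descent zero t)
gap-descent (suc r) zero    = refl
gap-descent (suc r) (suc t) = gap-descent (suc r) t

gap-append : ∀ t r w → gap r (w ++ descent t) ≡ gap r w + bonus t r (ups w)
gap-append t r       []      = gap-descent r t
gap-append t zero    (U ∷ w) = refl
gap-append t (suc r) (U ∷ w) = gap-append t r w
gap-append t zero    (D ∷ w) = cong suc (gap-append t zero w)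
gap-append t (suc r) (D ∷ w) = gap-append t (suc r) w

binom : ℕ → ℕ → ℕ
binom n       zero    = 1
binom zero    (suc c) = 0
binom (suc n) (suc c) = binom n c + binom n (suc c)

binom⁻ : ℕ → ℕ → ℕ
binom⁻ n zero    = 0
binom⁻ n (suc c) = binom n c

binom≡C : ∀ n c → binom n c ≡ n C c
binom≡C n       zero    = sym (trans (nCk≡nC[n∸k] {k = 0} {n = n} z≤n) (nCn≡1 n))
binom≡C zero    (suc c) = sym (k>n⇒nCk≡0 {n = 0} {k = suc c} (s≤s z≤n))
binom≡C (suc n) (suc c) =
  trans (cong₂ _+_ (binom≡C n c) (binom≡C n (suc c))) (nCk+nC[k+1]≡[n+1]C[k+1] n c)

pascal : ∀ M a → binom (suc M) a ≡ binom⁻ M a + binom M a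
pascal M zero    = refl
pascal M (suc a) = refl

absorption : ∀ n c → suc c * binom n (suc c) + c * binom n c ≡ n * binom n c
absorption zero    zero    = refl
absorption zero    (suc c) = cong₂ _+_ (*-zeroʳ (suc (suc c))) (*-zeroʳ (suc c))
absorption (suc n) zero    = cong suc (absorption n zero)
absorption (suc n) (suc c) = begin
  suc (suc c) * (y + z) + suc c * (x + y)
    ≡⟨ regroup c x y z ⟩
  (suc (suc c) * z + suc c * y) + (suc c * y + c * x) + (x + y)
    ≡⟨ cong (_+ (x + y)) (cong₂ _+_ (absorption n (suc c)) (absorption n c)) ⟩
  n * y + n * x + (x + y)
    ≡⟨ collect n x y ⟩
  suc n * (x + y) ∎
  where
  x = binom n c
  y = binom n (suc c)
  z = binom n (suc (suc c))
  regroup : ∀ c x y z → suc (suc c) * (y + z) + suc c * (x + y) ≡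
                        (suc (suc c) * z + suc c * y) + (suc c * y + c * x) + (x + y)
  regroup = solve-∀
  collect : ∀ n x y → n * y + n * x + (x + y) ≡ suc n * (x + y)
  collect = solve-∀

fuss-absorption : ∀ k a b → k * suc a ≡ b → binom (a + b) (suc a) ≡ k * binom (a + b) a
fuss-absorption k a .(k * suc a) refl =
  *-cancelˡ-≡ _ _ (suc a) (+-cancelʳ-≡ (a * B₀) _ _
    (trans (absorption (a + k * suc a) a) (expand k a B₀)))
  where
  B₀ = binom (a + k * suc a) a
  expand : ∀ k a B → (a + k * suc a) * B ≡ suc a * (k * B) + a * B
  expand = solve-∀

module _ (k : ℕ) where

  walks : ℕ → ℕ → ℕ → ℕ
  walks h a b = weight (walkOK k 0 h) one (words a b)

  ballot : ∀ h a b → h + k * a ≡ b →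
           walks h a b + k * binom⁻ (a + b) a ≡ binom (a + b) a
  ballot zero    zero    zero    _ = cong suc (*-zeroʳ k)
  ballot zero    zero    (suc b) e = ⊥-elim (0≢1+n (trans (sym (*-zeroʳ k)) e))
  ballot (suc h) zero    zero    ()
  ballot (suc h) zero    (suc b) e =
    trans (cong (_+ k * 0) (weight-map (walkOK k 0 (suc h)) one (D ∷_) (words 0 b)))
          (ballot h zero b (suc-injective e))
  ballot zero    (suc a) b       e = begin
    walks 0 (suc a) b + k * binom⁻ (suc (a + b)) (suc a)
      ≡⟨ cong₂ _+_ (up-first k 0 one a b) (cong (k *_) (pascal (a + b) a)) ⟩
    walks k a b + k * (binom⁻ (a + b) a + binom (a + b) a)
      ≡⟨ cong (walks k a b +_) (*-distribˡ-+ k _ _) ⟩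
    walks k a b + (k * binom⁻ (a + b) a + k * binom (a + b) a)
      ≡⟨ sym (+-assoc (walks k a b) _ _) ⟩
    walks k a b + k * binom⁻ (a + b) a + k * binom (a + b) a
      ≡⟨ cong₂ _+_ (ballot k a b (trans (sym (*-suc k a)) e))
                   (sym (fuss-absorption k a b e)) ⟩
    binom (a + b) a + binom (a + b) (suc a) ∎
  ballot (suc h) (suc a) zero    ()
  ballot (suc h) (suc a) (suc b) e = begin
    walks (suc h) (suc a) (suc b) + k * binom⁻ (suc M) (suc a)
      ≡⟨ cong₂ _+_ (weight-words-suc _ one a b) (cong (k *_) (pascal M a)) ⟩
    (p₁ + p₂) + k * (binom⁻ M a + binom M a)
      ≡⟨ interchange k p₁ p₂ (binom⁻ M a) (binom M a) ⟩
    (p₁ + k * binom⁻ M a) + (p₂ + k * binom M a)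
      ≡⟨ cong₂ _+_ (ballot (suc h + k) a (suc b) up-balance) down-count ⟩
    binom M a + binom M (suc a) ∎
    where
    M  = a + suc b
    p₁ = walks (suc h + k) a (suc b)
    p₂ = walks h (suc a) b
    interchange : ∀ k p q x y → (p + q) + k * (x + y) ≡ (p + k * x) + (q + k * y)
    interchange = solve-∀
    up-balance : suc h + k + k * a ≡ suc b
    up-balance = trans (+-assoc (suc h) k (k * a)) (trans (cong (suc h +_) (sym (*-suc k a))) e)
    down-count : p₂ + k * binom M a ≡ binom M (suc a)
    down-count = subst (λ m → p₂ + k * binom m a ≡ binom m (suc a)) (sym (+-suc a b))
                       (ballot h (suc a) b (suc-injective e))

dyckCount : ℕ → ℕ → ℕ → ℕ
dyckCount k t n = weight (isDyck k t) one (words n (k * n))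

s-weight : ∀ k n t r → s k n t r ≡ weight (isDyck k t) (gap r) (words n (k * n))
s-weight k n t r = weight-filter (isDyck k t) (gap r) (words n (k * n))

fuss-catalan : ∀ k n → suc n * dyckCount k 0 (suc n) ≡ binom (suc k * suc n) n
fuss-catalan k n = +-cancelʳ-≡ (suc n * (k * Y) + n * Y) _ _ (begin
  suc n * P + (suc n * (k * Y) + n * Y)
    ≡⟨ factor n P (k * Y) Y ⟩
  suc n * (P + k * Y) + n * Y
    ≡⟨ cong (λ m → suc n * m + n * Y) (ballot k 0 (suc n) (k * suc n) refl) ⟩
  suc n * binom L (suc n) + n * Y
    ≡⟨ absorption L n ⟩
  L * Y
    ≡⟨ expand k n Y ⟩
  Y + (suc n * (k * Y) + n * Y) ∎)
  where
  L = suc k * suc n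
  Y = binom L n
  P = dyckCount k 0 (suc n)
  factor : ∀ n P KY Y → suc n * P + (suc n * KY + n * Y) ≡ suc n * (P + KY) + n * Y
  factor = solve-∀
  expand : ∀ k n Y → suc k * suc n * Y ≡ Y + (suc n * (k * Y) + n * Y)
  expand = solve-∀

Cnk≡dyckCount : ∀ k n → Cnk n k ≡ dyckCount k 0 (suc n)
Cnk≡dyckCount k n = begin
  (suc k * (L C n)) / L
    ≡⟨ cong (λ y → (suc k * y) / L) (trans (sym (binom≡C L n)) (sym (fuss-catalan k n))) ⟩
  (suc k * (suc n * P)) / L
    ≡⟨ cong (_/ L) (rearrange k n P) ⟩
  (P * L) / L
    ≡⟨ m*n/n≡m P L ⟩
  P ∎
  where
  L = suc k * suc n
  P = dyckCount k 0 (suc n)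
  rearrange : ∀ k n P → suc k * (suc n * P) ≡ P * (suc k * suc n)
  rearrange = solve-∀

dyck-reduction : ∀ k n f → weight (isDyck k 0) f (words (suc n) (k * suc n)) ≡
                          weight (isDyck k k) (λ w → f (U ∷ w ++ descent k)) (words n (k * n))
dyck-reduction k n f = begin
  weight (walkOK k 0 0) f (words (suc n) (k * suc n))
    ≡⟨ up-first k 0 f n (k * suc n) ⟩
  weight (walkOK k 0 k) (λ w → f (U ∷ w)) (words n (k * suc n))
    ≡⟨ cong (λ b → weight (walkOK k 0 k) (λ w → f (U ∷ w)) (words n b))
            (trans (*-suc k n) (+-comm k (k * n))) ⟩
  weight (walkOK k 0 k) (λ w → f (U ∷ w)) (words n (k * n + k))
    ≡⟨ target-shift k k ≤-refl k n (k * n) (λ w → f (U ∷ w)) ⟩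
  weight (walkOK k k k) (λ w → f (U ∷ w ++ descent k)) (words n (k * n)) ∎

shifted-gaps : ∀ k n r → s k (suc n) 0 (suc r) ≡ s k n k r + bonus k r n * dyckCount k k n
shifted-gaps k n r = begin
  s k (suc n) 0 (suc r)
    ≡⟨ s-weight k (suc n) 0 (suc r) ⟩
  weight (isDyck k 0) (gap (suc r)) (words (suc n) (k * suc n))
    ≡⟨ dyck-reduction k n (gap (suc r)) ⟩
  weight P (λ w → gap r (w ++ descent k)) W
    ≡⟨ weight-cong P W (All.universal (gap-append k r) W) ⟩
  weight P (λ w → gap r w + bonus k r (ups w)) W
    ≡⟨ weight-+ P (gap r) _ W ⟩
  weight P (gap r) W + weight P (λ w → bonus k r (ups w)) W
    ≡⟨ cong₂ _+_ (sym (s-weight k n k r)) (weight-cong P W bonus-constant) ⟩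
  s k n k r + weight P (λ _ → bonus k r n) W
    ≡⟨ cong (s k n k r +_) (weight-const P (bonus k r n) W) ⟩
  s k n k r + bonus k r n * dyckCount k k n ∎
  where
  P = isDyck k k
  W = words n (k * n)
  -- every word in W has n up-steps, so the bonus is the same for all of them
  bonus-constant : All (λ w → bonus k r (ups w) ≡ bonus k r n) W
  bonus-constant = All.map (λ shape → cong (bonus k r) (proj₁ shape)) (words-shape n (k * n))

dyckCount≡Cnk : ∀ k n → dyckCount k k n ≡ Cnk n k
dyckCount≡Cnk k n = trans (sym (dyck-reduction k n one)) (sym (Cnk≡dyckCount k n))

proposition3p8 : (k n : ℕ) → 1 ≤ k → 1 ≤ n →
    ((r : ℕ) → r < n → s k (suc n) 0 (suc r) ≡ s k n k r)
    × (s k (suc n) 0 (suc n) ≡ s k n k n + k * Cnk n k)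
proposition3p8 k n _ _ = inner-gaps , last-gap
  where
  inner-gaps : (r : ℕ) → r < n → s k (suc n) 0 (suc r) ≡ s k n k r
  inner-gaps r r<n = begin
    s k (suc n) 0 (suc r)
      ≡⟨ shifted-gaps k n r ⟩
    s k n k r + bonus k r n * dyckCount k k n
      ≡⟨ cong (λ c → s k n k r + c * dyckCount k k n) (bonus-< k r<n) ⟩
    s k n k r + 0
      ≡⟨ +-identityʳ _ ⟩
    s k n k r ∎
  last-gap : s k (suc n) 0 (suc n) ≡ s k n k n + k * Cnk n k
  last-gap = begin
    s k (suc n) 0 (suc n)
      ≡⟨ shifted-gaps k n n ⟩
    s k n k n + bonus k n n * dyckCount k k n
      ≡⟨ cong₂ (λ c d → s k n k n + c * d) (bonus-self k n) (dyckCount≡Cnk k n) ⟩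
    s k n k n + k * Cnk n k ∎
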